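{- Let $(U,\mathcal{F})$ be a $q$-acceptant convex geometry for some $1\le q\le|U|$. Then any essential set $C$ of $(U,\mathcal{F})$ has a unique inclusion-wise maximal quasi-closed set.
   Context: All sets are finite. A closure system is a pair $(U,\mathcal{F})$ with $\mathcal{F}\subseteq 2^U$, $U\in\mathcal{F}$, closed under intersection; closure operator $\phi(A)=\bigcap\{C\in\mathcal{F}:A\subseteq C\}$. $(U,\mathcal{F})$ is a convex geometry if $\emptyset\in\mathcal{F}$ and for every closed $C\subsetneq U$ there is $x\notin C$ with $C\cup\{x\}$ closed. $\mathrm{ex}(A)=\{x\in A: x\notin\phi(A\setminus\{x\})\}$. A convex geometry is $q$-acceptant if $|\mathrm{ex}(C)|=\min(q,|C|)$ for every closed set $C$. A set $Q$ is quasi-closed if $Q$ is not closed and for every $A\subseteq Q$, $\phi(A)\subsetneq\phi(Q)$ implies $\phi(A)\subseteq Q$. A closed set $C$ is essential if $C=\phi(Q)$ for some quasi-closed $Q$; the quasi-closed sets of $C$ are the quasi-closed $Q$ with $\phi(Q)=C$. -}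

module Defs where

open import Data.Nat using (ℕ; zero; suc; _⊓_)
open import Data.Bool using (Bool; true; false; _∧_; not)
open import Data.Vec using (Vec; []; _∷_; tabulate; lookup)
open import Data.List using (List; []; _∷_; _++_; map; filter)
open import Data.List.Membership.Propositional using () renaming (_∈_ to _∈ᴸ_)
open import Data.Fin using (Fin)
open import Data.Fin.Subset using (Subset; _⊆_; _⊂_; _∩_; _∪_; ⋂; _-_; ∣_∣; ⁅_⁆; _∉_)
  renaming (⊤ to Uₛ; ⊥ to ∅ₛ)
open import Data.Fin.Subset.Properties using (_⊆?_)
open import Data.Product using (Σ; ∃; _×_; _,_)
open import Relation.Binary.PropositionalEquality using (_≡_; _≢_)
open import Relation.Nullary using (¬_)

-- The ground set U is Fin n; a family 𝓕 ⊆ 2^U is given as a list of subsets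
-- (duplicates are harmless).  "C is closed" means C ∈ 𝓕.

Closed : {n : ℕ} → List (Subset n) → Subset n → Set
Closed 𝓕 C = C ∈ᴸ 𝓕

φ : {n : ℕ} → List (Subset n) → Subset n → Subset n
φ 𝓕 A = ⋂ (filter (A ⊆?_) 𝓕)

record ClosureSystem {n : ℕ} (𝓕 : List (Subset n)) : Set where
  field
    U-closed : Closed 𝓕 Uₛ
    ∩-closed : ∀ A B → Closed 𝓕 A → Closed 𝓕 B → Closed 𝓕 (A ∩ B)

record ConvexGeometry {n : ℕ} (𝓕 : List (Subset n)) : Set where
  field
    closureSystem : ClosureSystem 𝓕
    ∅-closed : Closed 𝓕 ∅ₛ
    extend : ∀ C → Closed 𝓕 C → C ≢ Uₛ →
             ∃ λ (x : Fin n) → x ∉ C × Closed 𝓕 (C ∪ ⁅ x ⁆)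

ex : {n : ℕ} → List (Subset n) → Subset n → Subset n
ex 𝓕 A = tabulate λ x → lookup A x ∧ not (lookup (φ 𝓕 (A - x)) x)

Acceptant : {n : ℕ} → ℕ → List (Subset n) → Set
Acceptant q 𝓕 = ∀ C → Closed 𝓕 C → ∣ ex 𝓕 C ∣ ≡ q ⊓ ∣ C ∣

QuasiClosed : {n : ℕ} → List (Subset n) → Subset n → Set
QuasiClosed 𝓕 Q = ¬ Closed 𝓕 Q × (∀ A → A ⊆ Q → φ 𝓕 A ⊂ φ 𝓕 Q → φ 𝓕 A ⊆ Q)

QuasiClosedOf : {n : ℕ} → List (Subset n) → Subset n → Subset n → Set
QuasiClosedOf 𝓕 C Q = QuasiClosed 𝓕 Q × φ 𝓕 Q ≡ C

Essential : {n : ℕ} → List (Subset n) → Subset n → Set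
Essential 𝓕 C = Closed 𝓕 C × ∃ λ Q → QuasiClosedOf 𝓕 C Q

MaximalQuasiClosedOf : {n : ℕ} → List (Subset n) → Subset n → Subset n → Set
MaximalQuasiClosedOf 𝓕 C Q =
  QuasiClosedOf 𝓕 C Q × (∀ Q' → QuasiClosedOf 𝓕 C Q' → Q ⊆ Q' → Q' ≡ Q)

-- Every quasi-closed set Q of C contains the extreme points of C, and Q - e is closed for
-- each extreme point e; hence |ex C| ≤ |Q| < |C| and acceptance forces |ex C| = q ≥ 1.
-- Fix e ∈ ex C and put S = ex C - e, so |S| = q - 1.  In a q-acceptant convex geometry the
-- closed sets lying between S and a closed X ⊇ S form a chain: two proper closed subsets
-- Y₁, Y₂ ⊊ X each miss an extreme point g of X (a point with X - g closed), these lie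
-- outside S ⊆ ex X, and since |ex X| ≤ |S| + 1 they coincide, so both Yᵢ fit inside the
-- smaller closed set X - g.
-- Applied to the sets Q - e, this makes the quasi-closed sets of C a chain, so a maximal
-- one (which exists by finiteness) is unique.
module Submission where

open import Defs
open import Data.Bool using (true; false; _∧_; not)
open import Data.Bool.Properties using () renaming (_≟_ to _≟ᵇ_)
open import Data.Empty using (⊥-elim)
open import Data.Fin using (Fin; zero; suc) renaming (_≟_ to _≟ᶠ_)
open import Data.Fin.Properties using (any?)
open import Data.Fin.Subset
open import Data.Fin.Subset.Induction using (Acc; acc; ⊂-wellFounded; ⊃-wellFounded)
open import Data.Fin.Subset.Properties
open import Data.List using (List; []; _∷_; filter)
open import Data.List.Membership.Propositional using () renaming (_∈_ to _∈ᴸ_)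
open import Data.List.Membership.Propositional.Properties using (∈-filter⁺; ∈-filter⁻)
import Data.List.Relation.Unary.Any as Any
open import Data.Nat using (ℕ; suc; _≤_; _<_; s<s)
open import Data.Nat.Properties
  using (≤-trans; ≤-<-trans; ≤-reflexive; ≤-total; <-irrefl; <-≤-trans; <⇒≱;
         m⊓n≤m; m≤n⇒m⊓n≡m; m≥n⇒m⊓n≡n)
open import Data.Product using (∃; _×_; _,_; proj₁; proj₂)
open import Data.Sum as Sum using (_⊎_; inj₁; inj₂)
open import Data.Vec using (_∷_; lookup; here; there)
open import Data.Vec.Properties using (≡-dec; []=⇒lookup; lookup⇒[]=; lookup∘tabulate)
open import Function using (_∘_)
open import Level using (Level; 0ℓ)
open import Relation.Binary.Definitions using (DecidableEquality)
open import Relation.Binary.PropositionalEquality using (_≡_; _≢_; refl; sym; trans; cong; subst)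
open import Relation.Nullary using (Dec; yes; no; ¬?; _×-dec_; _→-dec_)
open import Relation.Nullary.Decidable using (decidable-stable)
open import Relation.Unary using (Pred; Decidable)

private variable
  ℓ : Level
  n : ℕ
  A B X Y : Subset n
  x y : Fin n

_≟ₛ_ : DecidableEquality (Subset n)
_≟ₛ_ = ≡-dec _≟ᵇ_

allSubsets? : {P : Pred (Subset n) ℓ} → Decidable P → Dec (∀ A → P A)
allSubsets? P? with anySubset? (¬? ∘ P?)
... | yes (A , ¬PA) = no λ ∀P → ¬PA (∀P A)
... | no ∄¬P = yes λ A → decidable-stable (P? A) λ ¬PA → ∄¬P (A , ¬PA)

⊆⇒≡⊎⊂ : A ⊆ B → A ≡ B ⊎ A ⊂ B
⊆⇒≡⊎⊂ {A = A} {B} A⊆B with any? (λ x → x ∈? B ×-dec ¬? (x ∈? A))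
... | yes B∖A = inj₂ (A⊆B , B∖A)
... | no ∄B∖A = inj₁ (⊆-antisym A⊆B λ {x} x∈B →
  decidable-stable (x ∈? A) λ x∉A → ∄B∖A (x , x∈B , x∉A))

x∉p-x : ∀ (p : Subset n) x → x ∉ p - x
x∉p-x (s ∷ p) zero ()
x∉p-x (s ∷ p) (suc x) (there x∈p-x) = x∉p-x p x x∈p-x

x∈p-y⇒x≢y : x ∈ A - y → x ≢ y
x∈p-y⇒x≢y {A = A} x∈A-x refl = x∉p-x A _ x∈A-x

p-x⊆p : ∀ (p : Subset n) x → p - x ⊆ p
p-x⊆p p x = p─q⊆p p ⁅ x ⁆

p⊆q∧x∉p⇒p⊆q-x : A ⊆ B → x ∉ A → A ⊆ B - x
p⊆q∧x∉p⇒p⊆q-x A⊆B x∉A y∈A = x∈p∧x≢y⇒x∈p-y (A⊆B y∈A) λ { refl → x∉A y∈A }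

p-x⊆q-x⇒p⊆q : x ∈ B → A - x ⊆ B - x → A ⊆ B
p-x⊆q-x⇒p⊆q {x = x} {B} x∈B A-x⊆B-x {y} y∈A with y ≟ᶠ x
... | yes refl = x∈B
... | no y≢x = p-x⊆p B x (A-x⊆B-x (x∈p∧x≢y⇒x∈p-y y∈A y≢x))

x∉p⇒p-x≡p : x ∉ A → A - x ≡ A
x∉p⇒p-x≡p {x = x} {A} x∉A = ⊆-antisym (p-x⊆p A x) (p⊆q∧x∉p⇒p⊆q-x ⊆-refl x∉A)

x∉p⇒[p∪⁅x⁆]-x≡p : x ∉ A → (A ∪ ⁅ x ⁆) - x ≡ A
x∉p⇒[p∪⁅x⁆]-x≡p {x = x} {A} x∉A = ⊆-antisym
  (λ {y} y∈ → case (x∈p∪q⁻ A ⁅ x ⁆ (p-x⊆p _ x y∈)) (x∈p-y⇒x≢y {A = A ∪ ⁅ x ⁆} y∈))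
  (p⊆q∧x∉p⇒p⊆q-x (p⊆p∪q ⁅ x ⁆) x∉A)
  where
  case : y ∈ A ⊎ y ∈ ⁅ x ⁆ → y ≢ x → y ∈ A
  case (inj₁ y∈A) _ = y∈A
  case (inj₂ y∈⁅x⁆) y≢x = ⊥-elim (y≢x (x∈⁅y⁆⇒x≡y x y∈⁅x⁆))

p⊆q⇒p∩q≡p : A ⊆ B → A ∩ B ≡ A
p⊆q⇒p∩q≡p {A = A} {B} A⊆B = ⊆-antisym (p∩q⊆p A B) λ x∈A → x∈p∩q⁺ (x∈A , A⊆B x∈A)

p⊆q⇒p-x⊆q-x : A ⊆ B → A - x ⊆ B - x
p⊆q⇒p-x⊆q-x {A = A} {x = x} A⊆B = p⊆q∧x∉p⇒p⊆q-x (A⊆B ∘ p-x⊆p A x) (x∉p-x A x)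

x∈p⇒⁅x⁆⊆p : x ∈ A → ⁅ x ⁆ ⊆ A
x∈p⇒⁅x⁆⊆p {x = x} {A} x∈A y∈⁅x⁆ = subst (_∈ A) (sym (x∈⁅y⁆⇒x≡y x y∈⁅x⁆)) x∈A

∪-least : A ⊆ X → B ⊆ X → A ∪ B ⊆ X
∪-least {A = A} {B = B} A⊆X B⊆X y∈A∪B with x∈p∪q⁻ A B y∈A∪B
... | inj₁ y∈A = A⊆X y∈A
... | inj₂ y∈B = B⊆X y∈B

x∉p⇒⁅x⁆∩p≡⊥ : x ∉ A → ⁅ x ⁆ ∩ A ≡ ⊥
x∉p⇒⁅x⁆∩p≡⊥ {x = x} {A} x∉A = ⊆-antisym
  (λ {y} y∈ → let y∈⁅x⁆ , y∈A = x∈p∩q⁻ ⁅ x ⁆ A y∈ in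
    ⊥-elim (x∉A (subst (_∈ A) (x∈⁅y⁆⇒x≡y x y∈⁅x⁆) y∈A)))
  (⊆-min (⁅ x ⁆ ∩ A))

∣p∣≡1+∣p-x∣ : ∀ (p : Subset n) {x} → x ∈ p → ∣ p ∣ ≡ suc ∣ p - x ∣
∣p∣≡1+∣p-x∣ (inside ∷ p) here = cong suc (sym (cong ∣_∣ (p─⊥≡p p)))
∣p∣≡1+∣p-x∣ (inside ∷ p) (there x∈p) = cong suc (∣p∣≡1+∣p-x∣ p x∈p)
∣p∣≡1+∣p-x∣ (outside ∷ p) (there x∈p) = ∣p∣≡1+∣p-x∣ p x∈p

1≤∣p∣⇒Nonempty : ∀ (p : Subset n) → 1 ≤ ∣ p ∣ → Nonempty p
1≤∣p∣⇒Nonempty {n} p 1≤∣p∣ with nonempty? p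
... | yes ne = ne
... | no empty with subst (1 ≤_) (trans (cong ∣_∣ (Empty-unique empty)) (∣⊥∣≡0 n)) 1≤∣p∣
...   | ()

∣q∣≤1+∣p∣⇒∈q∖p-unique : A ⊆ B → ∣ B ∣ ≤ suc ∣ A ∣ →
                        x ∈ B → x ∉ A → y ∈ B → y ∉ A → x ≡ y
∣q∣≤1+∣p∣⇒∈q∖p-unique {A = A} {B} {x} {y} A⊆B ∣B∣≤1+∣A∣ x∈B x∉A y∈B y∉A with x ≟ᶠ y
... | yes x≡y = x≡y
... | no x≢y = ⊥-elim (<⇒≱ (<-≤-trans ∣A∣<∣B-x∣+1 (x∈p⇒∣p-x∣<∣p∣ x∈B)) ∣B∣≤1+∣A∣)
  where
  ∣A∣<∣B-x∣+1 : suc ∣ A ∣ < suc ∣ B - x ∣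
  ∣A∣<∣B-x∣+1 = s<s (p⊂q⇒∣p∣<∣q∣
    (p⊆q∧x∉p⇒p⊆q-x A⊆B x∉A , y , x∈p∧x≢y⇒x∈p-y y∈B (x≢y ∘ sym) , y∉A))

⊆⋂ : ∀ (ps : List (Subset n)) → (∀ {p} → p ∈ᴸ ps → A ⊆ p) → A ⊆ ⋂ ps
⊆⋂ [] A⊆ps x∈A = ∈⊤
⊆⋂ (p ∷ ps) A⊆ps x∈A = x∈p∩q⁺ (A⊆ps (Any.here refl) x∈A , ⊆⋂ ps (A⊆ps ∘ Any.there) x∈A)

⋂⊆ : ∀ {p} (ps : List (Subset n)) → p ∈ᴸ ps → ⋂ ps ⊆ p
⋂⊆ (p ∷ ps) (Any.here refl) = p∩q⊆p p (⋂ ps)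
⋂⊆ (q ∷ ps) (Any.there p∈ps) = ⋂⊆ ps p∈ps ∘ p∩q⊆q q (⋂ ps)

Maximal : (P : Pred (Subset n) ℓ) → Pred (Subset n) ℓ
Maximal P M = P M × (∀ M′ → P M′ → M ⊆ M′ → M′ ≡ M)

∃-maximal : {P : Pred (Subset n) ℓ} → Decidable P → P A → ∃ (Maximal P)
∃-maximal {A = A} {P = P} P? PA = go A PA (⊃-wellFounded A)
  where
  go : ∀ A → P A → Acc _⊃_ A → ∃ (Maximal P)
  go A PA (acc rec) with anySubset? (λ B → P? B ×-dec A ⊂? B)
  ... | yes (B , PB , A⊂B) = go B PB (rec A⊂B)
  ... | no ∄larger = A , PA , larger⇒≡
    where
    larger⇒≡ : ∀ B → P B → A ⊆ B → B ≡ A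
    larger⇒≡ B PB A⊆B with ⊆⇒≡⊎⊂ A⊆B
    ... | inj₁ A≡B = sym A≡B
    ... | inj₂ A⊂B = ⊥-elim (∄larger (B , PB , A⊂B))

chain⇒maximal-unique : {P : Pred (Subset n) ℓ} →
                       (∀ {A B} → P A → P B → A ⊆ B ⊎ B ⊆ A) →
                       ∀ {M M′} → Maximal P M → Maximal P M′ → M′ ≡ M
chain⇒maximal-unique chain {M} {M′} (PM , M-max) (PM′ , M′-max) with chain PM PM′
... | inj₁ M⊆M′ = M-max M′ PM′ M⊆M′
... | inj₂ M′⊆M = sym (M′-max M PM M′⊆M)

module _ {𝓕 : List (Subset n)} where

  closed? : Decidable (Closed 𝓕)
  closed? A = Any.any? (A ≟ₛ_) 𝓕

  quasiClosedOf? : ∀ C → Decidable (QuasiClosedOf 𝓕 C)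
  quasiClosedOf? C Q = (¬? (closed? Q) ×-dec allSubsets? condition?) ×-dec (φ 𝓕 Q ≟ₛ C)
    where
    condition? : ∀ A → Dec (A ⊆ Q → φ 𝓕 A ⊂ φ 𝓕 Q → φ 𝓕 A ⊆ Q)
    condition? A = A ⊆? Q →-dec φ 𝓕 A ⊂? φ 𝓕 Q →-dec φ 𝓕 A ⊆? Q

  φ-extensive : ∀ A → A ⊆ φ 𝓕 A
  φ-extensive A = ⊆⋂ (filter (A ⊆?_) 𝓕) (proj₂ ∘ ∈-filter⁻ (A ⊆?_) {xs = 𝓕})

  φ-least : ∀ {A C} → Closed 𝓕 C → A ⊆ C → φ 𝓕 A ⊆ C
  φ-least {A} C∈𝓕 A⊆C = ⋂⊆ (filter (A ⊆?_) 𝓕) (∈-filter⁺ (A ⊆?_) C∈𝓕 A⊆C)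

  ∈ex⁻ : x ∈ ex 𝓕 A → x ∈ A × x ∉ φ 𝓕 (A - x)
  ∈ex⁻ {x = x} {A} x∈ex = split (trans (sym (lookup∘tabulate _ x)) ([]=⇒lookup x∈ex))
    where
    split : lookup A x ∧ not (lookup (φ 𝓕 (A - x)) x) ≡ true → x ∈ A × x ∉ φ 𝓕 (A - x)
    split eq with lookup A x in A[x] | lookup (φ 𝓕 (A - x)) x in φ[x] | eq
    ... | true | false | refl =
      lookup⇒[]= x A A[x] , λ x∈φ → true≢false (trans (sym ([]=⇒lookup x∈φ)) φ[x])
      where
      true≢false : true ≢ false
      true≢false ()

  ∈ex⁺ : x ∈ A → x ∉ φ 𝓕 (A - x) → x ∈ ex 𝓕 A
  ∈ex⁺ {x = x} {A} x∈A x∉φ =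
    lookup⇒[]= x (ex 𝓕 A) (trans (lookup∘tabulate _ x) (join ([]=⇒lookup x∈A)))
    where
    join : lookup A x ≡ true → lookup A x ∧ not (lookup (φ 𝓕 (A - x)) x) ≡ true
    join A[x] with lookup (φ 𝓕 (A - x)) x in φ[x]
    ... | true = ⊥-elim (x∉φ (lookup⇒[]= x _ φ[x]))
    ... | false rewrite A[x] = refl

  ex⊆ : ∀ A → ex 𝓕 A ⊆ A
  ex⊆ A = proj₁ ∘ ∈ex⁻

  p-x-closed⇒∈ex : x ∈ X → Closed 𝓕 (X - x) → x ∈ ex 𝓕 X
  p-x-closed⇒∈ex {x = x} {X} x∈X X-x∈𝓕 = ∈ex⁺ x∈X (x∉p-x X x ∘ φ-least X-x∈𝓕 ⊆-refl)

  quasiClosedOf⇒⊆ : ∀ {C Q} → QuasiClosedOf 𝓕 C Q → Q ⊆ C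
  quasiClosedOf⇒⊆ {Q = Q} (_ , refl) = φ-extensive Q

  ∣ex∣<∣C∣⇒∣ex∣≡q : ∀ {q C} → Acceptant q 𝓕 → Closed 𝓕 C → ∣ ex 𝓕 C ∣ < ∣ C ∣ → ∣ ex 𝓕 C ∣ ≡ q
  ∣ex∣<∣C∣⇒∣ex∣≡q {q} {C} q-acc C∈𝓕 ∣ex∣<∣C∣ with ≤-total q ∣ C ∣
  ... | inj₁ q≤∣C∣ = trans (q-acc C C∈𝓕) (m≤n⇒m⊓n≡m q≤∣C∣)
  ... | inj₂ ∣C∣≤q = ⊥-elim (<-irrefl (trans (q-acc C C∈𝓕) (m≥n⇒m⊓n≡n ∣C∣≤q)) ∣ex∣<∣C∣)

  module ClosureSystemProperties (cs : ClosureSystem 𝓕) where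
    open ClosureSystem cs

    ⋂-closed : ∀ (Cs : List (Subset n)) → (∀ {C} → C ∈ᴸ Cs → Closed 𝓕 C) → Closed 𝓕 (⋂ Cs)
    ⋂-closed [] Cs⊆𝓕 = U-closed
    ⋂-closed (C ∷ Cs) Cs⊆𝓕 =
      ∩-closed C (⋂ Cs) (Cs⊆𝓕 (Any.here refl)) (⋂-closed Cs (Cs⊆𝓕 ∘ Any.there))

    φ-closed : ∀ A → Closed 𝓕 (φ 𝓕 A)
    φ-closed A = ⋂-closed (filter (A ⊆?_) 𝓕) (proj₁ ∘ ∈-filter⁻ (A ⊆?_) {xs = 𝓕})

    φ-mono : A ⊆ B → φ 𝓕 A ⊆ φ 𝓕 B
    φ-mono {B = B} A⊆B = φ-least (φ-closed B) (φ-extensive B ∘ A⊆B)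

    φ⊆⇒closed : φ 𝓕 A ⊆ A → Closed 𝓕 A
    φ⊆⇒closed {A = A} φA⊆A = subst (Closed 𝓕) (⊆-antisym φA⊆A (φ-extensive A)) (φ-closed A)

    ∈ex-anti : x ∈ ex 𝓕 B → A ⊆ B → x ∈ A → x ∈ ex 𝓕 A
    ∈ex-anti x∈exB A⊆B x∈A = ∈ex⁺ x∈A (proj₂ (∈ex⁻ x∈exB) ∘ φ-mono (p⊆q⇒p-x⊆q-x A⊆B))

    quasiClosedOf-ex-closed : ∀ {C Q e} → QuasiClosedOf 𝓕 C Q → e ∈ ex 𝓕 C → Closed 𝓕 (Q - e)
    quasiClosedOf-ex-closed {Q = Q} {e} ((_ , φ⊂⇒⊆Q) , refl) e∈exC =
      φ⊆⇒closed (p⊆q∧x∉p⇒p⊆q-x φ[Q-e]⊆Q e∉φ[Q-e])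
      where
      e∉φ[Q-e] : e ∉ φ 𝓕 (Q - e)
      e∉φ[Q-e] = proj₂ (∈ex⁻ e∈exC) ∘ φ-mono (p⊆q⇒p-x⊆q-x (φ-extensive Q))
      φ[Q-e]⊆Q : φ 𝓕 (Q - e) ⊆ Q
      φ[Q-e]⊆Q = φ⊂⇒⊆Q (Q - e) (p-x⊆p Q e) (φ-mono (p-x⊆p Q e) , e , ex⊆ _ e∈exC , e∉φ[Q-e])

    ex⊆quasiClosedOf : ∀ {C Q} → QuasiClosedOf 𝓕 C Q → ex 𝓕 C ⊆ Q
    ex⊆quasiClosedOf {Q = Q} Q-qc {e} e∈exC = decidable-stable (e ∈? Q) λ e∉Q →
      proj₁ (proj₁ Q-qc) (subst (Closed 𝓕) (x∉p⇒p-x≡p e∉Q) (quasiClosedOf-ex-closed Q-qc e∈exC))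

    ∣ex∣<∣C∣ : ∀ {C Q} → Closed 𝓕 C → QuasiClosedOf 𝓕 C Q → ∣ ex 𝓕 C ∣ < ∣ C ∣
    ∣ex∣<∣C∣ C∈𝓕 Q-qc with ⊆⇒≡⊎⊂ (quasiClosedOf⇒⊆ Q-qc)
    ... | inj₁ refl = ⊥-elim (proj₁ (proj₁ Q-qc) C∈𝓕)
    ... | inj₂ Q⊂C = ≤-<-trans (p⊆q⇒∣p∣≤∣q∣ (ex⊆quasiClosedOf Q-qc)) (p⊂q⇒∣p∣<∣q∣ Q⊂C)

  module ConvexGeometryProperties (cg : ConvexGeometry 𝓕) where
    open ConvexGeometry cg
    open ClosureSystem closureSystem
    open ClosureSystemProperties closureSystem

    ⊂-closed⇒∃-addable : Closed 𝓕 X → Closed 𝓕 Y → Y ⊂ X →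
                         ∃ λ z → z ∈ X × z ∉ Y × Closed 𝓕 (Y ∪ ⁅ z ⁆)
    ⊂-closed⇒∃-addable {X = X} {Y} X∈𝓕 Y∈𝓕 (Y⊆X , x , x∈X , x∉Y) =
      go Y Y∈𝓕 (p⊆q⇒p∩q≡p Y⊆X) (⊃-wellFounded Y)
      where
      x∉ : ∀ {W} → W ∩ X ≡ Y → x ∉ W
      x∉ W∩X≡Y x∈W = x∉Y (subst (x ∈_) W∩X≡Y (x∈p∩q⁺ (x∈W , x∈X)))

      ∪⁅⁆-∩ : ∀ {W} w → W ∩ X ≡ Y → (W ∪ ⁅ w ⁆) ∩ X ≡ Y ∪ ⁅ w ⁆ ∩ X
      ∪⁅⁆-∩ {W} w W∩X≡Y = trans (∩-distribʳ-∪ X W ⁅ w ⁆) (cong (_∪ ⁅ w ⁆ ∩ X) W∩X≡Y)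

      -- Walk up a chain of one-point extensions of Y until it first picks up a point of X.
      go : ∀ W → Closed 𝓕 W → W ∩ X ≡ Y → Acc _⊃_ W →
           ∃ λ z → z ∈ X × z ∉ Y × Closed 𝓕 (Y ∪ ⁅ z ⁆)
      go W W∈𝓕 W∩X≡Y (acc rec)
        with extend W W∈𝓕 (λ W≡⊤ → x∉ W∩X≡Y (subst (x ∈_) (sym W≡⊤) ∈⊤))
      ... | w , w∉W , W+w∈𝓕 with w ∈? X
      ... | yes w∈X = w , w∈X , w∉W ∘ p∩q⊆p W X ∘ subst (w ∈_) (sym W∩X≡Y) ,
            subst (Closed 𝓕) (trans (∪⁅⁆-∩ w W∩X≡Y) (cong (Y ∪_) (p⊆q⇒p∩q≡p (x∈p⇒⁅x⁆⊆p w∈X))))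
                  (∩-closed _ X W+w∈𝓕 X∈𝓕)
      ... | no w∉X = go (W ∪ ⁅ w ⁆) W+w∈𝓕
            (trans (∪⁅⁆-∩ w W∩X≡Y) (trans (cong (Y ∪_) (x∉p⇒⁅x⁆∩p≡⊥ w∉X)) (∪-identityʳ Y)))
            (rec (p⊆p∪q ⁅ w ⁆ , w , q⊆p∪q W ⁅ w ⁆ (x∈⁅x⁆ w) , w∉W))

    ⊂-closed⇒∃-removable : Closed 𝓕 X → Closed 𝓕 Y → Y ⊂ X →
                           ∃ λ g → g ∈ X × g ∉ Y × Closed 𝓕 (X - g)
    ⊂-closed⇒∃-removable {X = X} {Y} X∈𝓕 Y∈𝓕 Y⊂X = go Y Y∈𝓕 Y⊂X (⊃-wellFounded Y)
      where
      go : ∀ Y → Closed 𝓕 Y → Y ⊂ X → Acc _⊃_ Y → ∃ λ g → g ∈ X × g ∉ Y × Closed 𝓕 (X - g)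
      go Y Y∈𝓕 Y⊂X (acc rec) with ⊂-closed⇒∃-addable X∈𝓕 Y∈𝓕 Y⊂X
      ... | z , z∈X , z∉Y , Y+z∈𝓕 with ⊆⇒≡⊎⊂ (∪-least (proj₁ Y⊂X) (x∈p⇒⁅x⁆⊆p z∈X))
      ... | inj₁ refl = z , z∈X , z∉Y , subst (Closed 𝓕) (sym (x∉p⇒[p∪⁅x⁆]-x≡p z∉Y)) Y∈𝓕
      ... | inj₂ Y+z⊂X with go (Y ∪ ⁅ z ⁆) Y+z∈𝓕 Y+z⊂X
                              (rec (p⊆p∪q ⁅ z ⁆ , z , q⊆p∪q Y ⁅ z ⁆ (x∈⁅x⁆ z) , z∉Y))
      ...   | g , g∈X , g∉Y+z , X-g∈𝓕 = g , g∈X , g∉Y+z ∘ p⊆p∪q ⁅ z ⁆ , X-g∈𝓕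

    ClosedBetween : Subset n → Subset n → Pred (Subset n) 0ℓ
    ClosedBetween S X Y = Closed 𝓕 Y × S ⊆ Y × Y ⊆ X

    closedBetween-chain : ∀ {q} → Acceptant q 𝓕 →
                          ∀ {S X} → Closed 𝓕 X → S ⊆ ex 𝓕 X → q ≤ suc ∣ S ∣ →
                          ∀ {Y₁ Y₂} → ClosedBetween S X Y₁ → ClosedBetween S X Y₂ →
                          Y₁ ⊆ Y₂ ⊎ Y₂ ⊆ Y₁
    closedBetween-chain {q} q-acc {S} {X} X∈𝓕 S⊆exX q≤1+∣S∣ = go X X∈𝓕 S⊆exX (⊂-wellFounded X)
      where
      ∣ex∣≤1+∣S∣ : ∀ {X} → Closed 𝓕 X → ∣ ex 𝓕 X ∣ ≤ suc ∣ S ∣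
      ∣ex∣≤1+∣S∣ {X} X∈𝓕 = ≤-trans (≤-reflexive (q-acc X X∈𝓕)) (≤-trans (m⊓n≤m q ∣ X ∣) q≤1+∣S∣)

      S⊆ex[X-g] : ∀ {X Y g} → S ⊆ ex 𝓕 X → S ⊆ Y → g ∉ Y → S ⊆ ex 𝓕 (X - g)
      S⊆ex[X-g] {X} {g = g} S⊆exX S⊆Y g∉Y s∈S =
        ∈ex-anti (S⊆exX s∈S) (p-x⊆p X g) (p⊆q∧x∉p⇒p⊆q-x (ex⊆ X ∘ S⊆exX) (g∉Y ∘ S⊆Y) s∈S)

      go : ∀ X → Closed 𝓕 X → S ⊆ ex 𝓕 X → Acc _⊂_ X →
           ∀ {Y₁ Y₂} → ClosedBetween S X Y₁ → ClosedBetween S X Y₂ → Y₁ ⊆ Y₂ ⊎ Y₂ ⊆ Y₁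
      go X X∈𝓕 S⊆exX (acc rec) (Y₁∈𝓕 , S⊆Y₁ , Y₁⊆X) (Y₂∈𝓕 , S⊆Y₂ , Y₂⊆X)
        with ⊆⇒≡⊎⊂ Y₁⊆X | ⊆⇒≡⊎⊂ Y₂⊆X
      ... | inj₁ refl | _ = inj₂ Y₂⊆X
      ... | inj₂ _ | inj₁ refl = inj₁ Y₁⊆X
      ... | inj₂ Y₁⊂X | inj₂ Y₂⊂X
        with ⊂-closed⇒∃-removable X∈𝓕 Y₁∈𝓕 Y₁⊂X | ⊂-closed⇒∃-removable X∈𝓕 Y₂∈𝓕 Y₂⊂X
      ... | g , g∈X , g∉Y₁ , X-g∈𝓕 | g′ , g′∈X , g′∉Y₂ , X-g′∈𝓕
        with ∣q∣≤1+∣p∣⇒∈q∖p-unique S⊆exX (∣ex∣≤1+∣S∣ X∈𝓕)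
               (p-x-closed⇒∈ex g∈X X-g∈𝓕) (g∉Y₁ ∘ S⊆Y₁) (p-x-closed⇒∈ex g′∈X X-g′∈𝓕) (g′∉Y₂ ∘ S⊆Y₂)
      ... | refl = go (X - g) X-g∈𝓕 (S⊆ex[X-g] S⊆exX S⊆Y₁ g∉Y₁) (rec (x∈p⇒p-x⊂p g∈X))
                     (Y₁∈𝓕 , S⊆Y₁ , p⊆q∧x∉p⇒p⊆q-x Y₁⊆X g∉Y₁)
                     (Y₂∈𝓕 , S⊆Y₂ , p⊆q∧x∉p⇒p⊆q-x Y₂⊆X g′∉Y₂)

    quasiClosedOf-chain : ∀ {q} → 1 ≤ q → Acceptant q 𝓕 → ∀ {C} → Closed 𝓕 C →
                          ∀ {Q₁ Q₂} → QuasiClosedOf 𝓕 C Q₁ → QuasiClosedOf 𝓕 C Q₂ →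
                          Q₁ ⊆ Q₂ ⊎ Q₂ ⊆ Q₁
    quasiClosedOf-chain {q} 1≤q q-acc {C} C∈𝓕 {Q₁} {Q₂} Q₁-qc Q₂-qc =
      chain-through (1≤∣p∣⇒Nonempty (ex 𝓕 C) (subst (1 ≤_) (sym ∣exC∣≡q) 1≤q))
      where
      ∣exC∣≡q : ∣ ex 𝓕 C ∣ ≡ q
      ∣exC∣≡q = ∣ex∣<∣C∣⇒∣ex∣≡q q-acc C∈𝓕 (∣ex∣<∣C∣ C∈𝓕 Q₁-qc)

      chain-through : Nonempty (ex 𝓕 C) → Q₁ ⊆ Q₂ ⊎ Q₂ ⊆ Q₁
      chain-through (e , e∈exC) = Sum.map (lift Q₂-qc) (lift Q₁-qc)
        (closedBetween-chain q-acc C∈𝓕 (p-x⊆p (ex 𝓕 C) e) q≤1+∣S∣ (between Q₁-qc) (between Q₂-qc))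
        where
        S : Subset n
        S = ex 𝓕 C - e

        q≤1+∣S∣ : q ≤ suc ∣ S ∣
        q≤1+∣S∣ = ≤-reflexive (trans (sym ∣exC∣≡q) (∣p∣≡1+∣p-x∣ (ex 𝓕 C) e∈exC))

        between : ∀ {Q} → QuasiClosedOf 𝓕 C Q → ClosedBetween S C (Q - e)
        between {Q} Q-qc = quasiClosedOf-ex-closed Q-qc e∈exC ,
                           p⊆q⇒p-x⊆q-x (ex⊆quasiClosedOf Q-qc) , quasiClosedOf⇒⊆ Q-qc ∘ p-x⊆p Q e

        lift : ∀ {P Q} → QuasiClosedOf 𝓕 C Q → P - e ⊆ Q - e → P ⊆ Q
        lift Q-qc = p-x⊆q-x⇒p⊆q (ex⊆quasiClosedOf Q-qc e∈exC)

lemma7 : (n q : ℕ) (𝓕 : List (Subset n)) → ConvexGeometry 𝓕 →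
         1 ≤ q → q ≤ n → Acceptant q 𝓕 →
         (C : Subset n) → Essential 𝓕 C →
         ∃ λ Q → MaximalQuasiClosedOf 𝓕 C Q ×
                 (∀ Q' → MaximalQuasiClosedOf 𝓕 C Q' → Q' ≡ Q)
lemma7 n q 𝓕 cg 1≤q _ q-acc C (C∈𝓕 , Q₀ , Q₀-qc) with ∃-maximal (quasiClosedOf? C) Q₀-qc
... | M , M-max = M , M-max , λ M′ M′-max →
  chain⇒maximal-unique (quasiClosedOf-chain 1≤q q-acc C∈𝓕) M-max M′-max
  where open ConvexGeometryProperties cg
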